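{- In $\mathrm{Res}(\oplus)$ refutations, each application of the weakening rule can be simulated by applications of the following syntactic rules: (i) simplification: from $D\lor(0=1)$ derive $D$; (ii) syntactic weakening: from $D$ derive $D\lor(f=\alpha)$; (iii) addition: from $D\lor(f_1=\alpha_1)\lor(f_2=\alpha_2)$ derive $D\lor(f_1=\alpha_1)\lor(f_1+f_2=\alpha_1+\alpha_2+1)$. Moreover, this simulation transforms a refutation of space $s$ into a refutation (using only the resolution rule and rules (i)--(iii)) of space at most $s+1$.
   Context: Linear clauses are disjunctions of linear literals $f=\alpha$ with $f$ a linear form over $\mathbb{F}_2$ and $\alpha\in\{0,1\}$. $\mathrm{Res}(\oplus)$ has the resolution rule (from $A\lor(f=0)$ and $B\lor(f=1)$ derive $A\lor B$) and the weakening rule (from $C$ derive any linear clause $D$ semantically implied by $C$, i.e. satisfied by every assignment satisfying $C$). A configuration is a set of linear clauses; a refutation of a linear CNF $\phi$ is a sequence of configurations $S_1=\emptyset,\dots,S_t$ with $S_t$ containing the empty clause, each obtained from the previous by download (add a clause of $\phi$), erasure (remove a clause), or inference (add a clause derived from clauses in the current configuration by a rule). Its space is $\max_i|S_i|$. -}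

module Defs where

open import Data.Bool using (Bool; true; false; _xor_; _∧_; not)
open import Data.Nat using (ℕ; suc; _⊔_; _≤_)
open import Data.Vec using (Vec; foldr; zipWith; replicate)
open import Data.List using (List; []; _∷_; _++_; length)
open import Data.List.Membership.Propositional using (_∈_)
open import Data.List.Relation.Unary.Any using (Any)
open import Data.Product using (Σ; _×_; _,_; ∃)
open import Data.Sum using (_⊎_)
open import Relation.Binary.PropositionalEquality using (_≡_)

-- Linear forms over F₂ in n variables: coefficient vectors (F₂ = Bool, + = xor, · = ∧).
LinForm : ℕ → Set
LinForm n = Vec Bool n

0f : ∀ {n} → LinForm n
0f {n} = replicate n false

_+f_ : ∀ {n} → LinForm n → LinForm n → LinForm n
f +f g = zipWith _xor_ f g

Assignment : ℕ → Set
Assignment n = Vec Bool n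

eval : ∀ {n} → LinForm n → Assignment n → Bool
eval f ρ = foldr _ _xor_ false (zipWith _∧_ f ρ)

Literal : ℕ → Set
Literal n = LinForm n × Bool

-- A linear clause: disjunction of linear literals (a finite set, represented as a list)
Clause : ℕ → Set
Clause n = List (Literal n)

CNF : ℕ → Set
CNF n = List (Clause n)

SatLit : ∀ {n} → Assignment n → Literal n → Set
SatLit ρ (f , α) = eval f ρ ≡ α

SatClause : ∀ {n} → Assignment n → Clause n → Set
SatClause ρ C = Any (SatLit ρ) C

_⊨_ : ∀ {n} → Clause n → Clause n → Set
C ⊨ D = ∀ ρ → SatClause ρ C → SatClause ρ D

_≈C_ : ∀ {n} → Clause n → Clause n → Set
C ≈C D = (∀ l → l ∈ C → l ∈ D) × (∀ l → l ∈ D → l ∈ C)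

falseLit : ∀ {n} → Literal n
falseLit = (0f , true)

Resolution : ∀ {n} → Clause n → Clause n → Clause n → Set
Resolution {n} C₁ C₂ E =
  Σ (Clause n) λ A → Σ (Clause n) λ B → Σ (LinForm n) λ f →
    (C₁ ≈C ((f , false) ∷ A)) × (C₂ ≈C ((f , true) ∷ B)) × (E ≈C (A ++ B))

Weakening : ∀ {n} → Clause n → Clause n → Set
Weakening C D = C ⊨ D

Simplification : ∀ {n} → Clause n → Clause n → Set
Simplification {n} C E = Σ (Clause n) λ D → (C ≈C (falseLit ∷ D)) × (E ≈C D)

SynWeakening : ∀ {n} → Clause n → Clause n → Set
SynWeakening {n} C E = Σ (Literal n) λ l → E ≈C (l ∷ C)

Addition : ∀ {n} → Clause n → Clause n → Set
Addition {n} C E =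
  Σ (Clause n) λ D → Σ (LinForm n) λ f₁ → Σ (LinForm n) λ f₂ → Σ Bool λ α₁ → Σ Bool λ α₂ →
    (C ≈C ((f₁ , α₁) ∷ (f₂ , α₂) ∷ D)) ×
    (E ≈C ((f₁ , α₁) ∷ (f₁ +f f₂ , not (α₁ xor α₂)) ∷ D))

Config : ℕ → Set
Config n = List (Clause n)

InferRule : Set₁
InferRule = ∀ {n} → Config n → Clause n → Set

ResXor : InferRule
ResXor S E =
  (∃ λ C₁ → ∃ λ C₂ → C₁ ∈ S × C₂ ∈ S × Resolution C₁ C₂ E)
  ⊎ (∃ λ C → C ∈ S × Weakening C E)

ResSyn : InferRule
ResSyn S E =
  (∃ λ C₁ → ∃ λ C₂ → C₁ ∈ S × C₂ ∈ S × Resolution C₁ C₂ E)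
  ⊎ (∃ λ C → C ∈ S × (Simplification C E ⊎ SynWeakening C E ⊎ Addition C E))

data Step (R : InferRule) {n} (φ : CNF n) : Config n → Config n → Set where
  download : ∀ {S C} → C ∈ φ → Step R φ S (C ∷ S)
  erasure  : ∀ xs C ys → Step R φ (xs ++ C ∷ ys) (xs ++ ys)
  infer    : ∀ {S C} → R S C → Step R φ S (C ∷ S)

data Run (R : InferRule) {n} (φ : CNF n) : Config n → Set where
  done : ∀ {S} → [] ∈ S → Run R φ S
  step : ∀ {S S'} → Step R φ S S' → Run R φ S' → Run R φ S

Refutation : InferRule → ∀ {n} → CNF n → Set
Refutation R φ = Run R φ []

space : ∀ {R : InferRule} {n} {φ : CNF n} {S} → Run R φ S → ℕ
space (done {S} _) = length S
space (step {S} _ r) = length S ⊔ space r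

-- Valid clauses can be dropped from every configuration: resolving against a valid clause is a
-- weakening of the other premise. A weakening C ⊨ D with D falsifiable is then simulated syntactically.
-- First weaken C to C ∨ D. For each literal l of C, l ∧ ¬D is unsatisfiable, so by Farkas' lemma over F₂
-- the equation 0 = 1 is the sum of l and some negated literals of D (l is needed since ¬D is
-- satisfiable). Adding these negations to l with the addition rule turns l into 0 = 1, which
-- simplification deletes. Each intermediate clause replaces its predecessor in the configuration, so
-- at most one clause more than in the original refutation is ever held.
module Submission where

open import Defs
open import Algebra.Bundles using (CommutativeRing)
open import Data.Bool using (Bool; true; false; _xor_; _∧_; not)
import Data.Bool as Bool
open import Data.Bool.Properties
  using (xor-assoc; xor-comm; xor-identityˡ; xor-identityʳ; xor-same; ∧-distribʳ-xor;
         not-distribˡ-xor; not-¬; ¬-not; xor-∧-commutativeRing)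
open import Algebra.Properties.CommutativeSemigroup
  (CommutativeRing.+-commutativeSemigroup xor-∧-commutativeRing) using (interchange)
open import Data.Empty using (⊥-elim)
open import Data.List using (List; []; _∷_; _++_; [_]; length; map; filter)
open import Data.List.Properties using (++-identityʳ; length-filter; filter-++)
open import Data.List.Membership.Propositional using (_∈_; lose)
open import Data.List.Membership.Propositional.Properties using (∈-map⁺; ∈-map⁻; ∈-filter⁺)
open import Data.List.Relation.Binary.Permutation.Propositional using (_↭_; ↭-sym)
open import Data.List.Relation.Binary.Permutation.Propositional.Properties using (shift)
open import Data.List.Relation.Binary.Subset.Propositional using (_⊆_)
open import Data.List.Relation.Binary.Subset.Propositional.Properties
  using (⊆-refl; ⊆-trans; ⊆-reflexive-↭; xs⊆x∷xs; ∈-∷⁺ʳ; xs⊆xs++ys; xs⊆ys++xs; Any-resp-⊆)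
open import Data.List.Relation.Unary.All using (All; []; _∷_)
import Data.List.Relation.Unary.All as All
open import Data.List.Relation.Unary.All.Properties using (¬Any⇒All¬; All¬⇒¬Any)
  renaming (map⁺ to All-map⁺; map⁻ to All-map⁻)
open import Data.List.Relation.Unary.Any using (here; there; any?)
open import Data.Nat using (ℕ; zero; suc; _+_; _≤_; _⊔_; s≤s)
open import Data.Nat.Properties
  using (≤-refl; ≤-trans; n≤1+n; m≤n+m; m≤m⊔n; m≤n⊔m; ⊔-lub; ⊔-monoˡ-≤; ⊔-monoʳ-≤)
open import Data.Product using (Σ; ∃; _,_)
import Data.Product as Product
import Data.Sum as Sum
open import Data.Sum using (_⊎_; inj₁; inj₂)
open import Data.Vec using ([]; _∷_; replicate)
open import Data.Vec.Properties using (zipWith-assoc; zipWith-comm; zipWith-identityˡ; zipWith-identityʳ)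
open import Function using (_∘_)
open import Relation.Binary.Construct.Closure.ReflexiveTransitive using (Star; ε; _◅_; _◅◅_; return)
open import Relation.Binary.PropositionalEquality
  using (_≡_; refl; sym; trans; cong; cong₂; subst; module ≡-Reasoning)
open import Relation.Nullary using (¬_; yes; no; contradiction)
open import Relation.Nullary.Decidable using (decidable-stable)
open import Relation.Unary using (Decidable)

private
  variable
    n : ℕ
    ρ : Assignment n
    x y l : Literal n
    A B C D E K : Clause n

eval-+ : (f g : LinForm n) (ρ : Assignment n) → eval (f +f g) ρ ≡ eval f ρ xor eval g ρ
eval-+ [] [] [] = refl
eval-+ (a ∷ f) (b ∷ g) (v ∷ ρ) = begin
  ((a xor b) ∧ v) xor eval (f +f g) ρ                 ≡⟨ cong₂ _xor_ (∧-distribʳ-xor v a b) (eval-+ f g ρ) ⟩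
  ((a ∧ v) xor (b ∧ v)) xor (eval f ρ xor eval g ρ)  ≡⟨ interchange (a ∧ v) (b ∧ v) (eval f ρ) (eval g ρ) ⟩
  ((a ∧ v) xor eval f ρ) xor ((b ∧ v) xor eval g ρ)  ∎
  where open ≡-Reasoning

eval-0f : (ρ : Assignment n) → eval 0f ρ ≡ false
eval-0f [] = refl
eval-0f (_ ∷ ρ) = eval-0f ρ

_⊕_ : Literal n → Literal n → Literal n
(f , α) ⊕ (g , β) = f +f g , α xor β

zeroLit : Literal n
zeroLit = 0f , false

neg : Literal n → Literal n
neg (f , α) = f , not α

⊕-assoc : (x y z : Literal n) → (x ⊕ y) ⊕ z ≡ x ⊕ (y ⊕ z)
⊕-assoc (f , α) (g , β) (h , γ) = cong₂ _,_ (zipWith-assoc xor-assoc f g h) (xor-assoc α β γ)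

⊕-comm : (x y : Literal n) → x ⊕ y ≡ y ⊕ x
⊕-comm (f , α) (g , β) = cong₂ _,_ (zipWith-comm xor-comm f g) (xor-comm α β)

⊕-identityˡ : (x : Literal n) → zeroLit ⊕ x ≡ x
⊕-identityˡ (f , α) = cong (_, α) (zipWith-identityˡ xor-identityˡ f)

⊕-identityʳ : (x : Literal n) → x ⊕ zeroLit ≡ x
⊕-identityʳ (f , α) = cong₂ _,_ (zipWith-identityʳ xor-identityʳ f) (xor-identityʳ α)

+f-same : (f : LinForm n) → f +f f ≡ 0f
+f-same [] = refl
+f-same (a ∷ f) = cong₂ _∷_ (xor-same a) (+f-same f)

⊕-same : (x : Literal n) → x ⊕ x ≡ zeroLit
⊕-same (f , α) = cong₂ _,_ (+f-same f) (xor-same α)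

⊕-cancelˡ : (x y : Literal n) → x ⊕ (x ⊕ y) ≡ y
⊕-cancelˡ x y = begin
  x ⊕ (x ⊕ y)  ≡⟨ sym (⊕-assoc x x y) ⟩
  (x ⊕ x) ⊕ y  ≡⟨ cong (_⊕ y) (⊕-same x) ⟩
  zeroLit ⊕ y  ≡⟨ ⊕-identityˡ y ⟩
  y            ∎
  where open ≡-Reasoning

⊕-swap : (x y z : Literal n) → x ⊕ (y ⊕ z) ≡ y ⊕ (x ⊕ z)
⊕-swap x y z = begin
  x ⊕ (y ⊕ z)  ≡⟨ sym (⊕-assoc x y z) ⟩
  (x ⊕ y) ⊕ z  ≡⟨ cong (_⊕ z) (⊕-comm x y) ⟩
  (y ⊕ x) ⊕ z  ≡⟨ ⊕-assoc y x z ⟩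
  y ⊕ (x ⊕ z)  ∎
  where open ≡-Reasoning

SatLit-⊕ : SatLit ρ x → SatLit ρ y → SatLit ρ (x ⊕ y)
SatLit-⊕ {ρ = ρ} {x = f , _} {y = g , _} sx sy = trans (eval-+ f g ρ) (cong₂ _xor_ sx sy)

falseLit-unsat : ¬ SatLit ρ (falseLit {n})
falseLit-unsat {ρ = ρ} s = contradiction (trans (sym (eval-0f ρ)) s) λ ()

data Span (E : List (Literal n)) : Literal n → Set where
  []  : Span E zeroLit
  _∷_ : ∀ {e x} → e ∈ E → Span E x → Span E (e ⊕ x)

private
  variable
    G G′ : List (Literal n)

span-sound : All (SatLit ρ) G → Span G x → SatLit ρ x
span-sound {ρ = ρ} sat [] = eval-0f ρ
span-sound sat (_∷_ {e} {x} e∈G s) = SatLit-⊕ {x = e} {y = x} (All.lookup sat e∈G) (span-sound sat s)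

span-∈ : x ∈ G → Span G x
span-∈ {x = x} x∈G = subst (Span _) (⊕-identityʳ x) (x∈G ∷ [])

span-⊕ : Span G x → Span G y → Span G (x ⊕ y)
span-⊕ {y = y} [] sy = subst (Span _) (sym (⊕-identityˡ y)) sy
span-⊕ {y = y} (_∷_ {e} {x} e∈G sx) sy = subst (Span _) (sym (⊕-assoc e x y)) (e∈G ∷ span-⊕ sx sy)

span-mono : G ⊆ G′ → Span G x → Span G′ x
span-mono G⊆G′ [] = []
span-mono G⊆G′ (e∈G ∷ s) = G⊆G′ e∈G ∷ span-mono G⊆G′ s

span-∷⁻ : Span (l ∷ G) x → Span G x ⊎ Span G (l ⊕ x)
span-∷⁻ [] = inj₁ []
span-∷⁻ {l = l} (here refl ∷ s) with span-∷⁻ s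
... | inj₁ s′ = inj₂ (subst (Span _) (sym (⊕-cancelˡ l _)) s′)
... | inj₂ s′ = inj₁ s′
span-∷⁻ {l = l} (_∷_ {e} {x} (there e∈G) s) with span-∷⁻ s
... | inj₁ s′ = inj₁ (e∈G ∷ s′)
... | inj₂ s′ = inj₂ (subst (Span _) (⊕-swap e l x) (e∈G ∷ s′))

Solvable : List (Literal n) → Set
Solvable {n} G = ∃ λ (ρ : Assignment n) → All (SatLit ρ) G

lift : Literal n → Literal (suc n)
lift (f , α) = false ∷ f , α

pivot : Literal n → Literal (suc n)
pivot (f , α) = true ∷ f , α

-- Eliminates the first variable using the equation pivot q.
reduce : Literal n → Literal (suc n) → Literal n
reduce q (false ∷ f , α) = f , α
reduce q (true ∷ f , α) = q ⊕ (f , α)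

span-lift : (∀ {e} → e ∈ G′ → Span G (lift e)) → Span G′ x → Span G (lift x)
span-lift h [] = []
span-lift h (e∈G′ ∷ s) = span-⊕ (h e∈G′) (span-lift h s)

pivot? : (G : List (Literal (suc n))) → (∃ λ q → pivot q ∈ G) ⊎ (∃ λ G′ → G ≡ map lift G′)
pivot? [] = inj₂ ([] , refl)
pivot? ((true ∷ f , α) ∷ G) = inj₁ ((f , α) , here refl)
pivot? ((false ∷ f , α) ∷ G) =
  Sum.map (Product.map₂ there) (Product.map ((f , α) ∷_) (cong (_ ∷_))) (pivot? G)

reduce-∈-span : ∀ {q e} → pivot q ∈ G → e ∈ map (reduce q) G → Span G (lift e)
reduce-∈-span {q = q} q∈G e∈G′ with ∈-map⁻ (reduce q) e∈G′
... | (false ∷ f , α) , e∈G , refl = span-∈ e∈G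
... | (true ∷ f , α) , e∈G , refl = span-⊕ (span-∈ q∈G) (span-∈ e∈G)

solve-pivot : (q : Literal n) (ρ : Assignment n) → ∃ λ v → SatLit (v ∷ ρ) (pivot q)
solve-pivot (f , α) ρ = α xor eval f ρ , (begin
  (α xor eval f ρ) xor eval f ρ  ≡⟨ xor-assoc α (eval f ρ) (eval f ρ) ⟩
  α xor (eval f ρ xor eval f ρ)  ≡⟨ cong (α xor_) (xor-same (eval f ρ)) ⟩
  α xor false                    ≡⟨ xor-identityʳ α ⟩
  α                              ∎)
  where open ≡-Reasoning

reduce-sat : ∀ {v q} → SatLit (v ∷ ρ) (pivot q) →
             (G : List (Literal (suc n))) → All (SatLit ρ) (map (reduce q) G) → All (SatLit (v ∷ ρ)) G
reduce-sat sq [] [] = []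
reduce-sat sq ((false ∷ f , α) ∷ G) (se ∷ sat) = se ∷ reduce-sat sq G sat
reduce-sat {ρ = ρ} {v} {q} sq (e@(true ∷ f , α) ∷ G) (se ∷ sat) =
  subst (SatLit (v ∷ ρ)) (⊕-cancelˡ (pivot q) e) (SatLit-⊕ {ρ = v ∷ ρ} {x = pivot q} {y = pivot q ⊕ e} sq se)
  ∷ reduce-sat sq G sat

-- Farkas' lemma over F₂, by Gaussian elimination of the first variable.
farkas : (G : List (Literal n)) → Solvable G ⊎ Span G falseLit
farkas {zero} [] = inj₁ ([] , [])
farkas {zero} (([] , true) ∷ G) = inj₂ (here refl ∷ [])
farkas {zero} (([] , false) ∷ G) =
  Sum.map (λ { ([] , sat) → [] , refl ∷ sat }) (span-mono there) (farkas G)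
farkas {suc n} G with pivot? G
... | inj₁ (q , q∈G) =
  Sum.map extend (span-lift (reduce-∈-span q∈G)) (farkas (map (reduce q) G))
  where
  extend : Solvable (map (reduce q) G) → Solvable G
  extend (ρ , sat) with solve-pivot q ρ
  ... | v , sq = v ∷ ρ , reduce-sat sq G sat
... | inj₂ (G′ , refl) =
  Sum.map (λ (ρ , sat) → false ∷ ρ , All-map⁺ sat) (span-lift (span-∈ ∘ ∈-map⁺ lift)) (farkas G′)

Falsifiable : Clause n → Set
Falsifiable {n} C = ∃ λ (ρ : Assignment n) → ¬ SatClause ρ C

Valid : Clause n → Set
Valid {n} C = (ρ : Assignment n) → SatClause ρ C

falsified⇒negations-hold : ¬ SatClause ρ C → All (SatLit ρ) (map neg C)
falsified⇒negations-hold {C = C} ρ⊭C = All-map⁺ (All.map ¬-not (¬Any⇒All¬ C ρ⊭C))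

negations-hold⇒falsified : All (SatLit ρ) (map neg C) → ¬ SatClause ρ C
negations-hold⇒falsified sat = All¬⇒¬Any (All.map (λ s s′ → not-¬ s′ s) (All-map⁻ sat))

falsifiable? : Decidable (Falsifiable {n})
falsifiable? C with farkas (map neg C)
... | inj₁ (ρ , sat) = yes (ρ , negations-hold⇒falsified sat)
... | inj₂ s = no λ (ρ , ρ⊭C) → falseLit-unsat {ρ = ρ} (span-sound (falsified⇒negations-hold ρ⊭C) s)

¬falsifiable⇒valid : ¬ Falsifiable C → Valid C
¬falsifiable⇒valid {C = C} nf ρ =
  decidable-stable (any? (λ (f , α) → eval f ρ Bool.≟ α) C) (λ ρ⊭C → nf (ρ , ρ⊭C))

falsifiable-[] : Falsifiable {n} []
falsifiable-[] {n} = replicate n false , λ ()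

falsifiable-⊨ : C ⊨ D → Falsifiable D → Falsifiable C
falsifiable-⊨ C⊨D (ρ , ρ⊭D) = ρ , ρ⊭D ∘ C⊨D ρ

≈C⇒⊆ : C ≈C D → C ⊆ D
≈C⇒⊆ (C⊆D , _) = C⊆D _

≈C⇒⊇ : C ≈C D → D ⊆ C
≈C⇒⊇ (_ , D⊆C) = D⊆C _

⊆⇒≈C : C ⊆ D → D ⊆ C → C ≈C D
⊆⇒≈C C⊆D D⊆C = (λ _ → C⊆D) , (λ _ → D⊆C)

≈C-refl : C ≈C C
≈C-refl = ⊆⇒≈C ⊆-refl ⊆-refl

∈⇒≈C-∷ : l ∈ C → C ≈C (l ∷ C)
∈⇒≈C-∷ {l = l} {C = C} l∈C = ⊆⇒≈C (xs⊆x∷xs C l) (∈-∷⁺ʳ l∈C ⊆-refl)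

↭⇒≈C : C ↭ D → C ≈C D
↭⇒≈C C↭D = ⊆⇒≈C (⊆-reflexive-↭ C↭D) (⊆-reflexive-↭ (↭-sym C↭D))

valid-cut : Valid (l ∷ A) → A ⊆ E → B ⊆ E → (neg l ∷ B) ⊨ E
valid-cut v A⊆E B⊆E ρ (here s) with v ρ
... | here s′ = ⊥-elim (not-¬ s′ s)
... | there sA = Any-resp-⊆ A⊆E sA
valid-cut v A⊆E B⊆E ρ (there sB) = Any-resp-⊆ B⊆E sB

valid-⊆ : C ⊆ D → Valid C → Valid D
valid-⊆ C⊆D v ρ = Any-resp-⊆ C⊆D (v ρ)

⊨-antimonoˡ : C ⊆ D → D ⊨ E → C ⊨ E
⊨-antimonoˡ C⊆D D⊨E ρ = D⊨E ρ ∘ Any-resp-⊆ C⊆D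

resolvent-of-validˡ : ¬ Falsifiable C → Resolution C D E → D ⊨ E
resolvent-of-validˡ nf (A , B , f , C≈ , D≈ , E≈) =
  ⊨-antimonoˡ (≈C⇒⊆ D≈) (valid-cut (valid-⊆ (≈C⇒⊆ C≈) (¬falsifiable⇒valid nf))
    (⊆-trans (xs⊆xs++ys A B) (≈C⇒⊇ E≈)) (⊆-trans (xs⊆ys++xs B A) (≈C⇒⊇ E≈)))

resolvent-of-validʳ : ¬ Falsifiable D → Resolution C D E → C ⊨ E
resolvent-of-validʳ nf (A , B , f , C≈ , D≈ , E≈) =
  ⊨-antimonoˡ (≈C⇒⊆ C≈) (valid-cut (valid-⊆ (≈C⇒⊆ D≈) (¬falsifiable⇒valid nf))
    (⊆-trans (xs⊆ys++xs B A) (≈C⇒⊇ E≈)) (⊆-trans (xs⊆xs++ys A B) (≈C⇒⊇ E≈)))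

SynRule : Clause n → Clause n → Set
SynRule C E = Simplification C E ⊎ SynWeakening C E ⊎ Addition C E

simplify : (K : Clause n) → SynRule (falseLit ∷ K) K
simplify K = inj₁ (K , ≈C-refl , ≈C-refl)

weaken-by : (C D : Clause n) → Star SynRule C (C ++ D)
weaken-by C [] = subst (Star SynRule C) (sym (++-identityʳ C)) ε
weaken-by C (d ∷ D) = weaken-by C D ◅◅ return (inj₂ (inj₁ (d , ↭⇒≈C (shift d C D))))

-- With (f₁ = α₁) := d, the new literal (f₁ + f₂ = α₁ + α₂ + 1) is c plus the negation of d.
add-negation : ∀ {d c} → d ∈ K → SynRule (c ∷ K) ((neg d ⊕ c) ∷ K)
add-negation {K = K} {d = f , α} {c = g , β} d∈K
  rewrite sym (not-distribˡ-xor α β) =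
  inj₂ (inj₂ (K , f , g , α , β , ∈⇒≈C-∷ (there d∈K) , ∈⇒≈C-∷ (there d∈K)))

add-negations : D ⊆ K → ∀ {y} → Span (map neg D) y → ∀ c → Star SynRule (c ∷ K) ((c ⊕ y) ∷ K)
add-negations {K = K} D⊆K [] c = subst (λ c′ → Star SynRule (c ∷ K) (c′ ∷ K)) (sym (⊕-identityʳ c)) ε
add-negations {K = K} D⊆K (_∷_ {x = y} e∈¬D s) c with ∈-map⁻ neg e∈¬D
... | d , d∈D , refl =
  add-negations D⊆K s c ◅◅
  return (subst (λ c′ → SynRule ((c ⊕ y) ∷ K) (c′ ∷ K)) (⊕-swap (neg d) c y) (add-negation (D⊆K d∈D)))

remove-literal : D ⊆ K → Span (map neg D) (l ⊕ falseLit) → Star SynRule (l ∷ K) K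
remove-literal {K = K} {l = l} D⊆K s =
  subst (λ c → Star SynRule (l ∷ K) (c ∷ K)) (⊕-cancelˡ l falseLit) (add-negations D⊆K s l)
  ◅◅ return (simplify K)

remove-all : (C : Clause n) → (∀ {l} → l ∈ C → Span (map neg D) (l ⊕ falseLit)) → Star SynRule (C ++ D) D
remove-all [] h = ε
remove-all {D = D} (l ∷ C) h = remove-literal (xs⊆ys++xs D C) (h (here refl)) ◅◅ remove-all C (h ∘ there)

eliminable : C ⊨ D → Falsifiable D → l ∈ C → Span (map neg D) (l ⊕ falseLit)
eliminable {D = D} {l = l} C⊨D (ρ₀ , ρ₀⊭D) l∈C with farkas (l ∷ map neg D)
... | inj₁ (ρ , sl ∷ sat) = ⊥-elim (negations-hold⇒falsified sat (C⊨D ρ (lose l∈C sl)))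
... | inj₂ s with span-∷⁻ s
...   | inj₁ s′ = ⊥-elim (falseLit-unsat {ρ = ρ₀} (span-sound (falsified⇒negations-hold ρ₀⊭D) s′))
...   | inj₂ s′ = s′

weakening⇒syntactic : C ⊨ D → Falsifiable D → Star SynRule C D
weakening⇒syntactic {C = C} {D = D} C⊨D fD = weaken-by C D ◅◅ remove-all C (eliminable C⊨D fD)

length≤space : ∀ {R : InferRule} {φ : CNF n} {S} (r : Run R φ S) → length S ≤ space r
length≤space (done _) = ≤-refl
length≤space (step _ r) = m≤m⊔n _ _

pruned : Config n → Config n
pruned = filter falsifiable?

module Simulation (φ : CNF n) where

  infix 4 _↝[_]_

  -- Continuation-passing form of a partial ResSyn run from S to S′ through configurations of size ≤ b.
  _↝[_]_ : Config n → ℕ → Config n → Set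
  S ↝[ b ] S′ = (r : Run ResSyn φ S′) → Σ (Run ResSyn φ S) λ r′ → space r′ ≤ b ⊔ space r

  private
    variable
      S S′ S″ T : Config n
      b b′ : ℕ

  ↝-refl : S ↝[ b ] S
  ↝-refl r = r , m≤n⊔m _ _

  ↝-step : length S ≤ b → Step ResSyn φ S S′ → S ↝[ b ] S′
  ↝-step S≤b s r = step s r , ⊔-monoˡ-≤ (space r) S≤b

  ↝-done : [] ∈ S → length S ≤ b → S ↝[ b ] S′
  ↝-done []∈S S≤b r = done []∈S , ≤-trans S≤b (m≤m⊔n _ _)

  infixr 5 _↝∘_

  _↝∘_ : S ↝[ b ] S′ → S′ ↝[ b ] S″ → S ↝[ b ] S″
  (p ↝∘ q) r with q r
  ... | r₁ , r₁≤ with p r₁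
  ...   | r₀ , r₀≤ = r₀ , ≤-trans r₀≤ (⊔-lub (m≤m⊔n _ _) r₁≤)

  ↝-mono : b ≤ b′ → S ↝[ b ] S′ → S ↝[ b′ ] S′
  ↝-mono b≤b′ p r with p r
  ... | r′ , r′≤ = r′ , ≤-trans r′≤ (⊔-monoˡ-≤ (space r) b≤b′)

  derive-in-place : Star SynRule C E → (C ∷ T) ↝[ 2 + length T ] (E ∷ T)
  derive-in-place ε = ↝-refl
  derive-in-place {T = T} (rule ◅ rules) =
    ↝-step (n≤1+n _) (infer (inj₂ (_ , here refl , rule)))
    ↝∘ ↝-step ≤-refl (erasure [ _ ] _ T)
    ↝∘ derive-in-place rules

  rederive : C ∈ T → T ↝[ 2 + length T ] (C ∷ T)
  rederive {C = []} []∈T = ↝-done []∈T (m≤n+m _ 2)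
  rederive {C = l ∷ C} C∈T =
    ↝-step (m≤n+m _ 2) (infer (inj₂ (_ , C∈T , inj₂ (inj₁ (l , ∈⇒≈C-∷ (here refl))))))

  derive-from : C ∈ T → Star SynRule C E → T ↝[ 2 + length T ] (E ∷ T)
  derive-from C∈T ε = rederive C∈T
  derive-from C∈T (rule ◅ rules) =
    ↝-step (m≤n+m _ 2) (infer (inj₂ (_ , C∈T , rule))) ↝∘ derive-in-place rules

  weakening-step : C ∈ S → C ⊨ E → Falsifiable E → pruned S ↝[ 2 + length (pruned S) ] (E ∷ pruned S)
  weakening-step C∈S C⊨E fE =
    derive-from (∈-filter⁺ falsifiable? C∈S (falsifiable-⊨ C⊨E fE)) (weakening⇒syntactic C⊨E fE)

  inference-step : ResXor S E → Falsifiable E → pruned S ↝[ 2 + length (pruned S) ] (E ∷ pruned S)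
  inference-step (inj₂ (_ , C∈S , C⊨E)) fE = weakening-step C∈S C⊨E fE
  inference-step (inj₁ (C , D , C∈S , D∈S , res)) fE with falsifiable? C | falsifiable? D
  ... | no nfC | _ = weakening-step D∈S (resolvent-of-validˡ nfC res) fE
  ... | yes _ | no nfD = weakening-step C∈S (resolvent-of-validʳ nfD res) fE
  ... | yes fC | yes fD =
    ↝-step (m≤n+m _ 2)
      (infer (inj₁ (C , D , ∈-filter⁺ falsifiable? C∈S fC , ∈-filter⁺ falsifiable? D∈S fD , res)))

  length-pruned≤ : (S : Config n) (m : ℕ) → length (pruned S) ≤ suc (length S ⊔ m)
  length-pruned≤ S m = ≤-trans (length-filter falsifiable? S) (≤-trans (m≤m⊔n _ m) (n≤1+n _))

  simulate-step : Step ResXor φ S S′ → pruned S ↝[ suc (length S ⊔ length S′) ] pruned S′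
  simulate-step {S = S} (download {C = C} C∈φ) with falsifiable? C
  ... | yes _ = ↝-step (length-pruned≤ S (length (C ∷ S))) (download C∈φ)
  ... | no _ = ↝-refl
  simulate-step (erasure xs C ys) with length-pruned≤ (xs ++ C ∷ ys) (length (xs ++ ys))
  ... | start≤ rewrite filter-++ falsifiable? xs (C ∷ ys) | filter-++ falsifiable? xs ys with falsifiable? C
  ...   | yes _ = ↝-step start≤ (erasure (pruned xs) C (pruned ys))
  ...   | no _ = ↝-refl
  simulate-step {S = S} (infer {C = E} rule) with falsifiable? E
  ... | yes fE =
    ↝-mono (s≤s (≤-trans (s≤s (length-filter falsifiable? S)) (m≤n⊔m _ _))) (inference-step rule fE)
  ... | no _ = ↝-refl

  simulate : (r : Run ResXor φ S) → Σ (Run ResSyn φ (pruned S)) λ r′ → space r′ ≤ suc (space r)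
  simulate {S = S} (done []∈S) =
    done (∈-filter⁺ falsifiable? []∈S falsifiable-[]) , ≤-trans (length-filter falsifiable? S) (n≤1+n _)
  simulate {S = S} (step {S' = S′} s r) with simulate r
  ... | r′ , r′≤ with simulate-step s r′
  ...   | r″ , r″≤ = r″ , ≤-trans r″≤ (⊔-lub step-bound (≤-trans r′≤ (s≤s (m≤n⊔m _ _))))
    where
    step-bound : suc (length S ⊔ length S′) ≤ suc (length S ⊔ space r)
    step-bound = s≤s (⊔-monoʳ-≤ (length S) (length≤space r))

lemma4p4 : (n : ℕ) (φ : CNF n) (π : Refutation ResXor φ) →
    Σ (Refutation ResSyn φ) (λ π′ → space π′ ≤ suc (space π))
lemma4p4 n φ π = Simulation.simulate φ π
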